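{- There exists a lattice polytope $P$ whose Ehrhart polynomial has only non-negative coefficients but such that the sequence $E_P(0),E_P(1),E_P(2),\ldots$ is not log-concave.
   Context: For a lattice polytope $P\subseteq\mathbb{R}^n$, $E_P$ is its Ehrhart polynomial, with $E_P(m)=\#(mP\cap\mathbb{Z}^n)$ for positive integers $m$ and $E_P(0)=1$. A sequence of positive reals $(a_j)$ is log-concave if $a_j^2\geq a_{j-1}a_{j+1}$ for all interior indices. -}

module Defs where

open import Data.Nat using (ℕ; zero; suc)
open import Data.Integer using (ℤ)
open import Data.Rational using (ℚ; 0ℚ; 1ℚ; _+_; _*_; _≤_; _/_)
import Data.Rational as ℚ
open import Data.Fin using (Fin)
import Data.Fin as Fin
open import Data.Vec using (Vec; lookup)
open import Data.List using (List; []; _∷_)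
open import Data.List.Relation.Unary.Unique.Propositional using (Unique)
open import Data.List.Membership.Propositional using (_∈_)
open import Data.Product using (Σ; _×_; ∃)
open import Function.Bundles using (_⇔_)
open import Relation.Binary.PropositionalEquality using (_≡_)

sumFin : {k : ℕ} → (Fin k → ℚ) → ℚ
sumFin {zero} f = 0ℚ
sumFin {suc k} f = f Fin.zero + sumFin (λ i → f (Fin.suc i))

ℤtoℚ : ℤ → ℚ
ℤtoℚ z = z / 1

ℕtoℚ : ℕ → ℚ
ℕtoℚ m = ℤtoℚ (Data.Integer.+ m)

-- A lattice polytope in ℝⁿ given as the convex hull of the finitely many
-- (at least one) lattice points  vs 0, …, vs k.
-- A lattice point x lies in the dilate m·conv(vs) iff x is a convex
-- combination of the points m·vs i.  (Since all data are rational, such a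
-- combination exists with real coefficients iff it exists with rational ones.)
InDilate : {n k : ℕ} → (Fin (suc k) → Vec ℤ n) → ℕ → Vec ℤ n → Set
InDilate {n} {k} vs m x =
  Σ (Fin (suc k) → ℚ) λ c →
    (∀ i → 0ℚ ≤ c i) ×
    (sumFin c ≡ 1ℚ) ×
    (∀ (j : Fin n) →
       ℤtoℚ (lookup x j) ≡ sumFin (λ i → c i * (ℕtoℚ m * ℤtoℚ (lookup (vs i) j))))

LatticeCount : {n k : ℕ} → (Fin (suc k) → Vec ℤ n) → ℕ → ℕ → Set
LatticeCount {n} vs m N =
  Σ (List (Vec ℤ n)) λ xs →
    Unique xs × (Data.List.length xs ≡ N) × (∀ x → (x ∈ xs) ⇔ InDilate vs m x)

-- Evaluation of a polynomial given by its coefficient list (constant term first).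
evalPoly : List ℚ → ℚ → ℚ
evalPoly [] t = 0ℚ
evalPoly (a ∷ as) t = a + t * evalPoly as t

data AllNonneg : List ℚ → Set where
  []  : AllNonneg []
  _∷_ : ∀ {a as} → 0ℚ ≤ a → AllNonneg as → AllNonneg (a ∷ as)

-- The witness is the Reeve tetrahedron T = conv{0, e₁, e₂, (1, 1, h)} with h = 12. Its dilate M·T is
-- cut out by z ≥ 0, z ≤ h x, z ≤ h y and h (x + y) ≤ h M + z, the four slacks being h M times the
-- barycentric coordinates. Writing z = σ + q h with 0 ≤ σ < h and δ σ = ⌈σ / h⌉, the lattice points of
-- M·T are the (δ σ + q + a, δ σ + q + b, z) with a, b ≥ 0 and 2 δ σ + q + a + b ≤ M: one copy of the
-- lattice points of the simplex M·Δ₃ and h − 1 copies of those of (M − 2)·Δ₃. Hence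
-- 6 E(M) = (M + 1)(M + 2)(M + 3) + (h − 1)(M − 1) M (M + 1), which for h = 12 is E(M) = 2M³ + M² + 1.
-- Its coefficients are non-negative, yet E(0) = 1, E(1) = 4, E(2) = 21 and 4² < 1 · 21.

module Submission where

open import Defs
open import Data.Nat using (ℕ; suc; _*_; _<_)
open import Data.Integer using (ℤ)
open import Data.Rational using (ℚ)
open import Data.Fin using (Fin)
open import Data.Vec using (Vec)
open import Data.List using (List; map)
open import Data.Product using (Σ; _×_; _,_)
open import Relation.Binary.PropositionalEquality using (_≡_; refl; sym; trans; cong; cong₂; subst; module ≡-Reasoning)
open import Data.Nat.Properties using (_<?_)
open import Relation.Nullary.Decidable using (from-yes)

module Embedding where

  open import Data.Nat as ℕ using (zero)
  open import Data.Integer as ℤ using (+_; -[1+_])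
  import Data.Integer.Properties as ℤ
  open import Data.Rational using (mkℚ; 0ℚ; _+_; _≤_; _/_; *≤*) renaming (_*_ to _·_)
  import Data.Rational as ℚ
  import Data.Rational.Properties as ℚ
  import Data.Nat.Coprimality as Coprime
  import Data.Fin as Fin
  open import Data.Vec using ([]; _∷_; lookup; sum)
  open import Data.List using ([]; _∷_)
  open import Relation.Binary.PropositionalEquality using (subst₂)

  ℤtoℚ≡mkℚ : ∀ z → ℤtoℚ z ≡ mkℚ z 0 (Coprime.sym (Coprime.1-coprimeTo _))
  ℤtoℚ≡mkℚ (+ n)    = ℚ.normalize-coprime (Coprime.sym (Coprime.1-coprimeTo _))
  ℤtoℚ≡mkℚ -[1+ n ] = cong ℚ.-_ (ℚ.normalize-coprime {suc n} {0} (Coprime.sym (Coprime.1-coprimeTo _)))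

  ℤtoℚ-homo-+ : ∀ a b → ℤtoℚ (a ℤ.+ b) ≡ ℤtoℚ a + ℤtoℚ b
  ℤtoℚ-homo-+ a b rewrite ℤtoℚ≡mkℚ a | ℤtoℚ≡mkℚ b =
    cong (_/ 1) (sym (cong₂ ℤ._+_ (ℤ.*-identityʳ a) (ℤ.*-identityʳ b)))

  ℤtoℚ-homo-* : ∀ a b → ℤtoℚ (a ℤ.* b) ≡ ℤtoℚ a · ℤtoℚ b
  ℤtoℚ-homo-* a b rewrite ℤtoℚ≡mkℚ a | ℤtoℚ≡mkℚ b = refl

  ℤtoℚ-cancel-≤ : ∀ {a b} → ℤtoℚ a ≤ ℤtoℚ b → a ℤ.≤ b
  ℤtoℚ-cancel-≤ {a} {b} p rewrite ℤtoℚ≡mkℚ a | ℤtoℚ≡mkℚ b with p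
  ... | *≤* q = subst₂ ℤ._≤_ (ℤ.*-identityʳ a) (ℤ.*-identityʳ b) q

  ℕtoℚ-homo-+ : ∀ a b → ℕtoℚ (a ℕ.+ b) ≡ ℕtoℚ a + ℕtoℚ b
  ℕtoℚ-homo-+ a b = trans (cong ℤtoℚ (ℤ.pos-+ a b)) (ℤtoℚ-homo-+ (+ a) (+ b))

  ℕtoℚ-homo-* : ∀ a b → ℕtoℚ (a ℕ.* b) ≡ ℕtoℚ a · ℕtoℚ b
  ℕtoℚ-homo-* a b = trans (cong ℤtoℚ (ℤ.pos-* a b)) (ℤtoℚ-homo-* (+ a) (+ b))

  ℕtoℚ-nonneg : ∀ n → 0ℚ ≤ ℕtoℚ n
  ℕtoℚ-nonneg n = ℚ.nonNegative⁻¹ _ {{ℚ.normalize-nonNeg n 1}}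

  ·-nonneg : ∀ {p q} → 0ℚ ≤ p → 0ℚ ≤ q → 0ℚ ≤ p · q
  ·-nonneg {p} {q} 0≤p 0≤q = ℚ.nonNegative⁻¹ _
    {{ℚ.nonNeg*nonNeg⇒nonNeg p {{ℚ.nonNegative 0≤p}} q {{ℚ.nonNegative 0≤q}}}}

  p≤p+q : ∀ p {q} → 0ℚ ≤ q → p ≤ p + q
  p≤p+q p {q} 0≤q = subst (_≤ p + q) (ℚ.+-identityʳ p) (ℚ.+-monoʳ-≤ p 0≤q)

  sumFin-·ʳ : ∀ {k} (f : Fin k → ℚ) u → sumFin (λ i → f i · u) ≡ sumFin f · u
  sumFin-·ʳ {zero}  f u = sym (ℚ.*-zeroˡ u)
  sumFin-·ʳ {suc k} f u = begin
    f _ · u + sumFin (λ i → f (Fin.suc i) · u) ≡⟨ cong (_+_ (f _ · u)) (sumFin-·ʳ (λ i → f (Fin.suc i)) u) ⟩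
    f _ · u + sumFin (λ i → f (Fin.suc i)) · u ≡⟨ ℚ.*-distribʳ-+ u (f _) _ ⟨
    sumFin f · u                               ∎
    where open ≡-Reasoning

  ℕtoℚ-sum : ∀ {k} (ns : Vec ℕ k) → sumFin (λ i → ℕtoℚ (lookup ns i)) ≡ ℕtoℚ (sum ns)
  ℕtoℚ-sum []       = refl
  ℕtoℚ-sum (n ∷ ns) = trans (cong (_+_ (ℕtoℚ n)) (ℕtoℚ-sum ns)) (sym (ℕtoℚ-homo-+ n _))

  evalPolyℕ : List ℕ → ℕ → ℕ
  evalPolyℕ []       t = 0
  evalPolyℕ (a ∷ as) t = a ℕ.+ t ℕ.* evalPolyℕ as t

  ℕtoℚ-evalPoly : ∀ as t → evalPoly (map ℕtoℚ as) (ℕtoℚ t) ≡ ℕtoℚ (evalPolyℕ as t)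
  ℕtoℚ-evalPoly []       t = refl
  ℕtoℚ-evalPoly (a ∷ as) t = begin
    ℕtoℚ a + ℕtoℚ t · evalPoly (map ℕtoℚ as) (ℕtoℚ t) ≡⟨ cong (λ e → ℕtoℚ a + ℕtoℚ t · e) (ℕtoℚ-evalPoly as t) ⟩
    ℕtoℚ a + ℕtoℚ t · ℕtoℚ (evalPolyℕ as t)          ≡⟨ cong (_+_ (ℕtoℚ a)) (ℕtoℚ-homo-* t _) ⟨
    ℕtoℚ a + ℕtoℚ (t ℕ.* evalPolyℕ as t)             ≡⟨ ℕtoℚ-homo-+ a _ ⟨
    ℕtoℚ (evalPolyℕ (a ∷ as) t)                      ∎
    where open ≡-Reasoning

  allNonneg-ℕtoℚ : ∀ as → AllNonneg (map ℕtoℚ as)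
  allNonneg-ℕtoℚ []       = []
  allNonneg-ℕtoℚ (a ∷ as) = ℕtoℚ-nonneg a ∷ allNonneg-ℕtoℚ as

module SimplexPoints where

  open import Data.Nat using (zero; _+_; _∸_; _≤_; _!; z≤n; s≤s)
  import Data.Nat.Properties as ℕ
  open import Data.Nat.Tactic.RingSolver using (solve-∀)
  open import Data.Vec using ([]; _∷_; sum)
  import Data.Vec.Properties as Vec
  open import Data.List using ([]; _∷_; [_]; _++_; length)
  import Data.List.Properties as List
  open import Data.List.Membership.Propositional using (_∈_)
  open import Data.List.Membership.Propositional.Properties using (∈-map⁺; ∈-map⁻; ∈-++⁺ˡ; ∈-++⁺ʳ; ∈-++⁻)
  open import Data.List.Relation.Unary.Any using (here)
  open import Data.List.Relation.Unary.All using ([])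
  open import Data.List.Relation.Unary.AllPairs using ([]; _∷_)
  open import Data.List.Relation.Unary.Unique.Propositional using (Unique)
  import Data.List.Relation.Unary.Unique.Propositional.Properties as Unique
  open import Data.Sum using (inj₁; inj₂)
  open import Data.Empty using (⊥)

  risingFactorial : ℕ → ℕ → ℕ
  risingFactorial a zero    = 1
  risingFactorial a (suc d) = a * risingFactorial (suc a) d

  risingFactorial-suc : ∀ a d → risingFactorial a (suc d) ≡ risingFactorial a d * (a + d)
  risingFactorial-suc a zero    = regroup a
    where
    regroup : ∀ a → a * 1 ≡ 1 * (a + 0)
    regroup = solve-∀
  risingFactorial-suc a (suc d) = begin
    a * risingFactorial (suc a) (suc d)           ≡⟨ cong (a *_) (risingFactorial-suc (suc a) d) ⟩
    a * (risingFactorial (suc a) d * (suc a + d)) ≡⟨ regroup a (risingFactorial (suc a) d) d ⟩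
    a * risingFactorial (suc a) d * (a + suc d)   ∎
    where
    open ≡-Reasoning
    regroup : ∀ a r d → a * (r * (suc a + d)) ≡ a * r * (a + suc d)
    regroup = solve-∀

  risingFactorial-one : ∀ d → risingFactorial 1 d ≡ d !
  risingFactorial-one zero    = refl
  risingFactorial-one (suc d) = begin
    risingFactorial 1 (suc d)   ≡⟨ risingFactorial-suc 1 d ⟩
    risingFactorial 1 d * suc d ≡⟨ cong (_* suc d) (risingFactorial-one d) ⟩
    d ! * suc d                 ≡⟨ ℕ.*-comm (d !) (suc d) ⟩
    suc d !                     ∎
    where open ≡-Reasoning

  sucHead : ∀ {d} → Vec ℕ (suc d) → Vec ℕ (suc d)
  sucHead (x ∷ v) = suc x ∷ v

  simplexPoints : (d K : ℕ) → List (Vec ℕ d)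
  simplexPoints zero    K       = [ [] ]
  simplexPoints (suc d) zero    = map (0 ∷_) (simplexPoints d zero)
  simplexPoints (suc d) (suc K) = map (0 ∷_) (simplexPoints d (suc K)) ++ map sucHead (simplexPoints (suc d) K)

  ∈-simplexPoints⁻ : ∀ d K {v : Vec ℕ d} → v ∈ simplexPoints d K → sum v ≤ K
  ∈-simplexPoints⁻ zero    K       {[]} _ = z≤n
  ∈-simplexPoints⁻ (suc d) zero    v∈ with ∈-map⁻ (0 ∷_) v∈
  ... | _ , w∈ , refl = ∈-simplexPoints⁻ d zero w∈
  ∈-simplexPoints⁻ (suc d) (suc K) v∈ with ∈-++⁻ (map (0 ∷_) (simplexPoints d (suc K))) v∈
  ... | inj₁ v∈₁ with ∈-map⁻ (0 ∷_) v∈₁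
  ...   | _ , w∈ , refl = ∈-simplexPoints⁻ d (suc K) w∈
  ∈-simplexPoints⁻ (suc d) (suc K) v∈ | inj₂ v∈₂ with ∈-map⁻ sucHead v∈₂
  ...   | _ ∷ _ , w∈ , refl = s≤s (∈-simplexPoints⁻ (suc d) K w∈)

  ∈-simplexPoints⁺ : ∀ d K {v : Vec ℕ d} → sum v ≤ K → v ∈ simplexPoints d K
  ∈-simplexPoints⁺ zero    K       {[]}        _         = here refl
  ∈-simplexPoints⁺ (suc d) zero    {zero ∷ v}  v≤K       = ∈-map⁺ (0 ∷_) (∈-simplexPoints⁺ d zero v≤K)
  ∈-simplexPoints⁺ (suc d) (suc K) {zero ∷ v}  v≤K       =
    ∈-++⁺ˡ (∈-map⁺ (0 ∷_) (∈-simplexPoints⁺ d (suc K) v≤K))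
  ∈-simplexPoints⁺ (suc d) (suc K) {suc x ∷ v} (s≤s v≤K) =
    ∈-++⁺ʳ (map (0 ∷_) (simplexPoints d (suc K))) (∈-map⁺ sucHead (∈-simplexPoints⁺ (suc d) K v≤K))

  sucHead-injective : ∀ {d} {v w : Vec ℕ (suc d)} → sucHead v ≡ sucHead w → v ≡ w
  sucHead-injective {v = _ ∷ _} {_ ∷ _} refl = refl

  simplexPoints-unique : ∀ d K → Unique (simplexPoints d K)
  simplexPoints-unique zero    K       = [] ∷ []
  simplexPoints-unique (suc d) zero    = Unique.map⁺ Vec.∷-injectiveʳ (simplexPoints-unique d zero)
  simplexPoints-unique (suc d) (suc K) =
    Unique.++⁺ (Unique.map⁺ Vec.∷-injectiveʳ (simplexPoints-unique d (suc K)))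
               (Unique.map⁺ sucHead-injective (simplexPoints-unique (suc d) K))
               disjoint
    where
    disjoint : ∀ {v} → v ∈ map (0 ∷_) (simplexPoints d (suc K)) × v ∈ map sucHead (simplexPoints (suc d) K) → ⊥
    disjoint (v∈₁ , v∈₂) with ∈-map⁻ (0 ∷_) v∈₁ | ∈-map⁻ sucHead v∈₂
    ... | _ , _ , refl | _ ∷ _ , _ , ()

  length-simplexPoints-zero : ∀ d → length (simplexPoints d zero) ≡ 1
  length-simplexPoints-zero zero    = refl
  length-simplexPoints-zero (suc d) = trans (List.length-map (0 ∷_) (simplexPoints d zero)) (length-simplexPoints-zero d)

  length-simplexPoints : ∀ d K → d ! * length (simplexPoints d K) ≡ risingFactorial (suc K) d
  length-simplexPoints zero    K       = refl
  length-simplexPoints (suc d) zero    = begin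
    suc d ! * length (simplexPoints (suc d) zero) ≡⟨ cong (suc d ! *_) (length-simplexPoints-zero (suc d)) ⟩
    suc d ! * 1                                   ≡⟨ ℕ.*-identityʳ (suc d !) ⟩
    suc d !                                       ≡⟨ risingFactorial-one (suc d) ⟨
    risingFactorial 1 (suc d)                     ∎
    where open ≡-Reasoning
  length-simplexPoints (suc d) (suc K) = begin
    suc d ! * length (simplexPoints (suc d) (suc K))
      ≡⟨ cong (suc d ! *_) length-split ⟩
    suc d ! * (length (simplexPoints d (suc K)) + length (simplexPoints (suc d) K))
      ≡⟨ regroup d (d !) (length (simplexPoints d (suc K))) _ ⟩
    suc d * (d ! * length (simplexPoints d (suc K))) + suc d ! * length (simplexPoints (suc d) K)
      ≡⟨ cong₂ (λ a b → suc d * a + b) (length-simplexPoints d (suc K)) (length-simplexPoints (suc d) K) ⟩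
    suc d * risingFactorial (suc (suc K)) d + suc K * risingFactorial (suc (suc K)) d
      ≡⟨ collect d K (risingFactorial (suc (suc K)) d) ⟩
    risingFactorial (suc (suc K)) d * (suc (suc K) + d)
      ≡⟨ risingFactorial-suc (suc (suc K)) d ⟨
    risingFactorial (suc (suc K)) (suc d) ∎
    where
    open ≡-Reasoning
    length-split : length (simplexPoints (suc d) (suc K)) ≡ length (simplexPoints d (suc K)) + length (simplexPoints (suc d) K)
    length-split = trans (List.length-++ (map (0 ∷_) (simplexPoints d (suc K))))
      (cong₂ _+_ (List.length-map (0 ∷_) (simplexPoints d (suc K))) (List.length-map sucHead (simplexPoints (suc d) K)))
    regroup : ∀ d f a b → (suc d * f) * (a + b) ≡ suc d * (f * a) + (suc d * f) * b
    regroup = solve-∀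
    collect : ∀ d K r → suc d * r + suc K * r ≡ r * (suc (suc K) + d)
    collect = solve-∀

  innerSimplexPoints : (d M : ℕ) → List (Vec ℕ d)
  innerSimplexPoints d (suc (suc K)) = simplexPoints d K
  innerSimplexPoints d _             = []

  ∈-innerSimplexPoints⁻ : ∀ d M {v : Vec ℕ d} → v ∈ innerSimplexPoints d M → 2 + sum v ≤ M
  ∈-innerSimplexPoints⁻ d (suc (suc K)) v∈ = s≤s (s≤s (∈-simplexPoints⁻ d K v∈))

  ∈-innerSimplexPoints⁺ : ∀ d M {v : Vec ℕ d} → 2 + sum v ≤ M → v ∈ innerSimplexPoints d M
  ∈-innerSimplexPoints⁺ d (suc (suc K)) (s≤s (s≤s v≤K)) = ∈-simplexPoints⁺ d K v≤K

  innerSimplexPoints-unique : ∀ d M → Unique (innerSimplexPoints d M)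
  innerSimplexPoints-unique d zero          = []
  innerSimplexPoints-unique d (suc zero)    = []
  innerSimplexPoints-unique d (suc (suc K)) = simplexPoints-unique d K

  length-innerSimplexPoints : ∀ d M → suc d ! * length (innerSimplexPoints (suc d) M) ≡ risingFactorial (M ∸ 1) (suc d)
  length-innerSimplexPoints d zero          = ℕ.*-zeroʳ (suc d !)
  length-innerSimplexPoints d (suc zero)    = ℕ.*-zeroʳ (suc d !)
  length-innerSimplexPoints d (suc (suc K)) = length-simplexPoints (suc d) K

module ReeveTetrahedron where

  open Embedding
  import Data.Nat as ℕ
  import Data.Nat.Properties as ℕ
  open import Data.Nat.Tactic.RingSolver using (solve-∀)
  open import Data.Integer as ℤ using (+_; -[1+_])
  import Data.Integer.Properties as ℤ
  open import Data.Rational using (0ℚ; 1ℚ; _+_; _≤_; 1/_; Positive; NonZero) renaming (_*_ to _·_)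
  import Data.Rational.Properties as ℚ
  open import Data.Rational.Solver using (module +-*-Solver)
  open import Data.Fin.Patterns using (0F; 1F; 2F; 3F)
  open import Data.Vec using ([]; _∷_; lookup; sum)
  open import Function.Bundles using (_⇔_; mk⇔)
  open import Relation.Binary.PropositionalEquality using (subst₂)

  reeve : ℕ → Fin 4 → Vec ℤ 3
  reeve h 0F = + 0 ∷ + 0 ∷ + 0 ∷ []
  reeve h 1F = + 0 ∷ + 1 ∷ + 0 ∷ []
  reeve h 2F = + 1 ∷ + 0 ∷ + 0 ∷ []
  reeve h 3F = + 1 ∷ + 1 ∷ + h ∷ []

  dilatedCombination : ∀ {n k} → (Fin (suc k) → Vec ℤ n) → (Fin (suc k) → ℚ) → ℚ → Fin n → ℚ
  dilatedCombination vs c t j = sumFin (λ i → c i · (t · ℤtoℚ (lookup (vs i) j)))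

  module _ (h : ℕ) (c : Fin 4 → ℚ) (t : ℚ) where
    open +-*-Solver using (solve; _:+_; _:*_; _:=_; con)

    reeve-coordinate-x : dilatedCombination (reeve h) c t 0F ≡ t · (c 2F + c 3F)
    reeve-coordinate-x = solve 5 (λ c₀ c₁ c₂ c₃ t →
        c₀ :* (t :* con 0ℚ) :+ (c₁ :* (t :* con 0ℚ) :+ (c₂ :* (t :* con 1ℚ) :+ (c₃ :* (t :* con 1ℚ) :+ con 0ℚ)))
      := t :* (c₂ :+ c₃)) refl (c 0F) (c 1F) (c 2F) (c 3F) t

    reeve-coordinate-y : dilatedCombination (reeve h) c t 1F ≡ t · (c 1F + c 3F)
    reeve-coordinate-y = solve 5 (λ c₀ c₁ c₂ c₃ t →
        c₀ :* (t :* con 0ℚ) :+ (c₁ :* (t :* con 1ℚ) :+ (c₂ :* (t :* con 0ℚ) :+ (c₃ :* (t :* con 1ℚ) :+ con 0ℚ)))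
      := t :* (c₁ :+ c₃)) refl (c 0F) (c 1F) (c 2F) (c 3F) t

    reeve-coordinate-z : dilatedCombination (reeve h) c t 2F ≡ t · (ℕtoℚ h · c 3F)
    reeve-coordinate-z = solve 6 (λ c₀ c₁ c₂ c₃ t H →
        c₀ :* (t :* con 0ℚ) :+ (c₁ :* (t :* con 0ℚ) :+ (c₂ :* (t :* con 0ℚ) :+ (c₃ :* (t :* H) :+ con 0ℚ)))
      := t :* (H :* c₃)) refl (c 0F) (c 1F) (c 2F) (c 3F) t (ℕtoℚ h)

  ReeveFacetsℤ : ℕ → ℕ → Vec ℤ 3 → Set
  ReeveFacetsℤ h M (x ∷ y ∷ z ∷ []) =
    + 0 ℤ.≤ z × z ℤ.≤ + h ℤ.* x × z ℤ.≤ + h ℤ.* y × + h ℤ.* (x ℤ.+ y) ℤ.≤ + h ℤ.* + M ℤ.+ z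

  inDilate⇒ReeveFacetsℤ : ∀ {h M} p → InDilate (reeve h) M p → ReeveFacetsℤ h M p
  inDilate⇒ReeveFacetsℤ {h} {M} (x ∷ y ∷ z ∷ []) (c , 0≤c , Σc≡1 , coordinate) =
    ℤtoℚ-cancel-≤ (subst (0ℚ ≤_) (sym z≡) (0≤t·H·c 3F)) ,
    below-vertex 2F x≡ ,
    below-vertex 1F y≡ ,
    ℤtoℚ-cancel-≤ opposite-facet
    where
    open ℚ.≤-Reasoning
    open +-*-Solver using (solve; _:+_; _:*_; _:=_; con)
    t = ℕtoℚ M
    H = ℕtoℚ h
    x≡ : ℤtoℚ x ≡ t · (c 2F + c 3F)
    x≡ = trans (coordinate 0F) (reeve-coordinate-x h c t)
    y≡ : ℤtoℚ y ≡ t · (c 1F + c 3F)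
    y≡ = trans (coordinate 1F) (reeve-coordinate-y h c t)
    z≡ : ℤtoℚ z ≡ t · (H · c 3F)
    z≡ = trans (coordinate 2F) (reeve-coordinate-z h c t)
    0≤t·H·c : ∀ i → 0ℚ ≤ t · (H · c i)
    0≤t·H·c i = ·-nonneg (ℕtoℚ-nonneg M) (·-nonneg (ℕtoℚ-nonneg h) (0≤c i))
    split : ∀ H t a b → H · (t · (a + b)) ≡ t · (H · b) + t · (H · a)
    split = solve 4 (λ H t a b → H :* (t :* (a :+ b)) := t :* (H :* b) :+ t :* (H :* a)) refl
    below-vertex : ∀ {a} i → ℤtoℚ a ≡ t · (c i + c 3F) → z ℤ.≤ + h ℤ.* a
    below-vertex {a} i a≡ = ℤtoℚ-cancel-≤ (begin
      ℤtoℚ z                            ≡⟨ z≡ ⟩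
      t · (H · c 3F)                    ≤⟨ p≤p+q _ (0≤t·H·c i) ⟩
      t · (H · c 3F) + t · (H · c i)    ≡⟨ split H t (c i) (c 3F) ⟨
      H · (t · (c i + c 3F))            ≡⟨ cong (H ·_) a≡ ⟨
      H · ℤtoℚ a                        ≡⟨ ℤtoℚ-homo-* (+ h) a ⟨
      ℤtoℚ (+ h ℤ.* a)                  ∎)
    collect : ∀ H t c₀ c₁ c₂ c₃ → H · (t · (c₂ + c₃) + t · (c₁ + c₃)) + t · (H · c₀)
                                  ≡ H · t · (c₀ + (c₁ + (c₂ + (c₃ + 0ℚ)))) + t · (H · c₃)
    collect = solve 6 (λ H t c₀ c₁ c₂ c₃ → H :* (t :* (c₂ :+ c₃) :+ t :* (c₁ :+ c₃)) :+ t :* (H :* c₀)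
                                  := H :* t :* (c₀ :+ (c₁ :+ (c₂ :+ (c₃ :+ con 0ℚ)))) :+ t :* (H :* c₃)) refl
    opposite-facet : ℤtoℚ (+ h ℤ.* (x ℤ.+ y)) ≤ ℤtoℚ (+ h ℤ.* + M ℤ.+ z)
    opposite-facet = begin
      ℤtoℚ (+ h ℤ.* (x ℤ.+ y))                     ≡⟨ ℤtoℚ-homo-* (+ h) (x ℤ.+ y) ⟩
      H · ℤtoℚ (x ℤ.+ y)                           ≡⟨ cong (H ·_) (trans (ℤtoℚ-homo-+ x y) (cong₂ _+_ x≡ y≡)) ⟩
      H · (t · (c 2F + c 3F) + t · (c 1F + c 3F))  ≤⟨ p≤p+q _ (0≤t·H·c 0F) ⟩
      H · (t · (c 2F + c 3F) + t · (c 1F + c 3F)) + t · (H · c 0F)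
        ≡⟨ collect H t (c 0F) (c 1F) (c 2F) (c 3F) ⟩
      H · t · sumFin c + t · (H · c 3F)            ≡⟨ cong (λ s → H · t · s + t · (H · c 3F)) Σc≡1 ⟩
      H · t · 1ℚ + t · (H · c 3F)                  ≡⟨ cong₂ _+_ (ℚ.*-identityʳ (H · t)) (sym z≡) ⟩
      H · t + ℤtoℚ z                               ≡⟨ cong (_+ ℤtoℚ z) (ℤtoℚ-homo-* (+ h) (+ M)) ⟨
      ℤtoℚ (+ h ℤ.* + M) + ℤtoℚ z                  ≡⟨ ℤtoℚ-homo-+ (+ h ℤ.* + M) z ⟨
      ℤtoℚ (+ h ℤ.* + M ℤ.+ z)                     ∎

  data ReeveFacets (h M : ℕ) : Vec ℤ 3 → Set where
    reeveFacets : ∀ {x y z} → z ℕ.≤ h ℕ.* x → z ℕ.≤ h ℕ.* y → h ℕ.* (x ℕ.+ y) ℕ.≤ h ℕ.* M ℕ.+ z →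
                  ReeveFacets h M (+ x ∷ + y ∷ + z ∷ [])

  -- For negative x, the integer + suc r ℤ.* x computes to a -[1+ _ ], so z ≤ h x is refuted by an absurd pattern.
  ReeveFacetsℤ⇒ReeveFacets : ∀ {r M} p → ReeveFacetsℤ (suc r) M p → ReeveFacets (suc r) M p
  ReeveFacetsℤ⇒ReeveFacets (_        ∷ _        ∷ -[1+ _ ] ∷ []) (() , _)
  ReeveFacetsℤ⇒ReeveFacets (-[1+ _ ] ∷ _        ∷ + _      ∷ []) (_ , () , _)
  ReeveFacetsℤ⇒ReeveFacets (+ _      ∷ -[1+ _ ] ∷ + _      ∷ []) (_ , _ , () , _)
  ReeveFacetsℤ⇒ReeveFacets {r} {M} (+ x ∷ + y ∷ + z ∷ []) (_ , z≤hx , z≤hy , h[x+y]≤hM+z) =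
    reeveFacets (drop (ℤ.pos-* (suc r) x) z≤hx) (drop (ℤ.pos-* (suc r) y) z≤hy)
      (ℤ.drop‿+≤+ (subst₂ ℤ._≤_ lhs rhs h[x+y]≤hM+z))
    where
    drop : ∀ {a b c} → + a ≡ b → + c ℤ.≤ b → c ℕ.≤ a
    drop refl = ℤ.drop‿+≤+
    lhs : + suc r ℤ.* (+ x ℤ.+ + y) ≡ + (suc r ℕ.* (x ℕ.+ y))
    lhs = sym (trans (ℤ.pos-* (suc r) (x ℕ.+ y)) (cong (+ suc r ℤ.*_) (ℤ.pos-+ x y)))
    rhs : + suc r ℤ.* + M ℤ.+ + z ≡ + (suc r ℕ.* M ℕ.+ z)
    rhs = sym (trans (ℤ.pos-+ (suc r ℕ.* M) z) (cong (ℤ._+ + z) (ℤ.pos-* (suc r) M)))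

  barycentric⇒inDilate : ∀ {r m x y z} s₀ s₁ s₂ →
    s₂ ℕ.+ z ≡ suc r ℕ.* x → s₁ ℕ.+ z ≡ suc r ℕ.* y → sum (s₀ ∷ s₁ ∷ s₂ ∷ z ∷ []) ≡ suc r ℕ.* suc m →
    InDilate (reeve (suc r)) (suc m) (+ x ∷ + y ∷ + z ∷ [])
  barycentric⇒inDilate {r} {m} {x} {y} {z} s₀ s₁ s₂ s₂+z≡hx s₁+z≡hy Σs≡hM = c , 0≤c , Σc≡1 , coordinate
    where
    open ≡-Reasoning
    h = suc r
    s = s₀ ∷ s₁ ∷ s₂ ∷ z ∷ []
    t = ℕtoℚ (suc m)
    D = ℕtoℚ (h ℕ.* suc m)
    instance
      D-positive : Positive D
      D-positive = ℚ.normalize-pos (h ℕ.* suc m) 1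
      D-nonZero : NonZero D
      D-nonZero = ℚ.pos⇒nonZero D
    u = 1/ D
    c : Fin 4 → ℚ
    c i = ℕtoℚ (lookup s i) · u
    0≤c : ∀ i → 0ℚ ≤ c i
    0≤c i = ·-nonneg (ℕtoℚ-nonneg (lookup s i)) (ℚ.nonNegative⁻¹ u {{ℚ.pos⇒nonNeg u {{ℚ.1/pos⇒pos D}}}})
    Σc≡1 : sumFin c ≡ 1ℚ
    Σc≡1 = begin
      sumFin c                                 ≡⟨ sumFin-·ʳ (λ i → ℕtoℚ (lookup s i)) u ⟩
      sumFin (λ i → ℕtoℚ (lookup s i)) · u     ≡⟨ cong (_· u) (trans (ℕtoℚ-sum s) (cong ℕtoℚ Σs≡hM)) ⟩
      D · u                                    ≡⟨ ℚ.*-inverseʳ D ⟩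
      1ℚ                                       ∎
    rescale : ∀ a → t · (ℕtoℚ (h ℕ.* a) · u) ≡ ℕtoℚ a
    rescale a = begin
      t · (ℕtoℚ (h ℕ.* a) · u)       ≡⟨ ℚ.*-assoc t _ u ⟨
      t · ℕtoℚ (h ℕ.* a) · u         ≡⟨ cong (_· u) (ℕtoℚ-homo-* (suc m) (h ℕ.* a)) ⟨
      ℕtoℚ (suc m ℕ.* (h ℕ.* a)) · u ≡⟨ cong (λ n → ℕtoℚ n · u) (regroup (suc m) h a) ⟩
      ℕtoℚ (a ℕ.* (h ℕ.* suc m)) · u ≡⟨ cong (_· u) (ℕtoℚ-homo-* a (h ℕ.* suc m)) ⟩
      ℕtoℚ a · D · u                 ≡⟨ ℚ.*-assoc (ℕtoℚ a) D u ⟩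
      ℕtoℚ a · (D · u)               ≡⟨ cong (ℕtoℚ a ·_) (ℚ.*-inverseʳ D) ⟩
      ℕtoℚ a · 1ℚ                    ≡⟨ ℚ.*-identityʳ (ℕtoℚ a) ⟩
      ℕtoℚ a                         ∎
      where
      regroup : ∀ m h a → m ℕ.* (h ℕ.* a) ≡ a ℕ.* (h ℕ.* m)
      regroup = solve-∀
    edge-coordinate : ∀ {a} n → n ℕ.+ z ≡ h ℕ.* a → t · (ℕtoℚ n · u + ℕtoℚ z · u) ≡ ℕtoℚ a
    edge-coordinate {a} n n+z≡ha = begin
      t · (ℕtoℚ n · u + ℕtoℚ z · u) ≡⟨ cong (t ·_) (ℚ.*-distribʳ-+ u (ℕtoℚ n) (ℕtoℚ z)) ⟨
      t · ((ℕtoℚ n + ℕtoℚ z) · u)   ≡⟨ cong (λ q → t · (q · u)) (ℕtoℚ-homo-+ n z) ⟨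
      t · (ℕtoℚ (n ℕ.+ z) · u)      ≡⟨ cong (λ k → t · (ℕtoℚ k · u)) n+z≡ha ⟩
      t · (ℕtoℚ (h ℕ.* a) · u)      ≡⟨ rescale a ⟩
      ℕtoℚ a                        ∎
    coordinate : ∀ j → ℤtoℚ (lookup (+ x ∷ + y ∷ + z ∷ []) j) ≡ dilatedCombination (reeve h) c t j
    coordinate 0F = sym (trans (reeve-coordinate-x h c t) (edge-coordinate s₂ s₂+z≡hx))
    coordinate 1F = sym (trans (reeve-coordinate-y h c t) (edge-coordinate s₁ s₁+z≡hy))
    coordinate 2F = sym (begin
      dilatedCombination (reeve h) c t 2F ≡⟨ reeve-coordinate-z h c t ⟩
      t · (ℕtoℚ h · (ℕtoℚ z · u))         ≡⟨ cong (t ·_) (ℚ.*-assoc (ℕtoℚ h) (ℕtoℚ z) u) ⟨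
      t · (ℕtoℚ h · ℕtoℚ z · u)           ≡⟨ cong (λ q → t · (q · u)) (ℕtoℚ-homo-* h z) ⟨
      t · (ℕtoℚ (h ℕ.* z) · u)            ≡⟨ rescale z ⟩
      ℕtoℚ z                              ∎)

  ReeveFacets⇒inDilate : ∀ {r m p} → ReeveFacets (suc r) (suc m) p → InDilate (reeve (suc r)) (suc m) p
  ReeveFacets⇒inDilate {r} {m} (reeveFacets {x} {y} {z} z≤hx z≤hy h[x+y]≤hM+z)
    with s₂ , z+s₂≡hx ← ℕ.m≤n⇒∃[o]m+o≡n z≤hx
       | s₁ , z+s₁≡hy ← ℕ.m≤n⇒∃[o]m+o≡n z≤hy
       | s₀ , h[x+y]+s₀≡hM+z ← ℕ.m≤n⇒∃[o]m+o≡n h[x+y]≤hM+z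
    = barycentric⇒inDilate {r} {m} s₀ s₁ s₂ (trans (ℕ.+-comm s₂ z) z+s₂≡hx) (trans (ℕ.+-comm s₁ z) z+s₁≡hy)
        (ℕ.+-cancelʳ-≡ z _ _ Σs+z≡hM+z)
    where
    open ≡-Reasoning
    h = suc r
    regroup : ∀ s₀ s₁ s₂ z → s₀ ℕ.+ (s₁ ℕ.+ (s₂ ℕ.+ (z ℕ.+ 0))) ℕ.+ z ≡ s₀ ℕ.+ ((z ℕ.+ s₂) ℕ.+ (z ℕ.+ s₁))
    regroup = solve-∀
    Σs+z≡hM+z : sum (s₀ ∷ s₁ ∷ s₂ ∷ z ∷ []) ℕ.+ z ≡ h ℕ.* suc m ℕ.+ z
    Σs+z≡hM+z = begin
      sum (s₀ ∷ s₁ ∷ s₂ ∷ z ∷ []) ℕ.+ z   ≡⟨ regroup s₀ s₁ s₂ z ⟩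
      s₀ ℕ.+ ((z ℕ.+ s₂) ℕ.+ (z ℕ.+ s₁)) ≡⟨ cong₂ (λ a b → s₀ ℕ.+ (a ℕ.+ b)) z+s₂≡hx z+s₁≡hy ⟩
      s₀ ℕ.+ (h ℕ.* x ℕ.+ h ℕ.* y)       ≡⟨ ℕ.+-comm s₀ _ ⟩
      h ℕ.* x ℕ.+ h ℕ.* y ℕ.+ s₀         ≡⟨ cong (ℕ._+ s₀) (ℕ.*-distribˡ-+ h x y) ⟨
      h ℕ.* (x ℕ.+ y) ℕ.+ s₀             ≡⟨ h[x+y]+s₀≡hM+z ⟩
      h ℕ.* suc m ℕ.+ z                  ∎

  inDilate⇔ReeveFacets : ∀ {r m p} → InDilate (reeve (suc r)) (suc m) p ⇔ ReeveFacets (suc r) (suc m) p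
  inDilate⇔ReeveFacets {p = p} =
    mk⇔ (λ p∈ → ReeveFacetsℤ⇒ReeveFacets p (inDilate⇒ReeveFacetsℤ p p∈)) ReeveFacets⇒inDilate

module ReeveLatticePoints where

  open SimplexPoints
  open ReeveTetrahedron
  open import Data.Nat using (zero; _+_; _∸_; _≤_; _!; z≤n; s≤s)
  import Data.Nat.Properties as ℕ
  open import Data.Nat.DivMod using (_%_; _divMod_; result; [m+kn]%n≡m%n; m<n⇒m%n≡m)
  open import Data.Nat.Tactic.RingSolver using (solve-∀)
  open import Data.Integer using (+_)
  import Data.Integer.Properties as ℤ
  open import Data.Fin as Fin using (toℕ)
  import Data.Fin.Properties as Fin
  open import Data.Vec using ([]; _∷_; sum)
  import Data.Vec.Properties as Vec
  open import Data.List using ([]; _∷_; _++_; length; allFin; cartesianProductWith)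
  import Data.List.Properties as List
  open import Data.List.Membership.Propositional using (_∈_)
  open import Data.List.Membership.Propositional.Properties
    using (∈-map⁺; ∈-map⁻; ∈-++⁺ˡ; ∈-++⁺ʳ; ∈-++⁻; ∈-cartesianProductWith⁺; ∈-cartesianProductWith⁻; ∈-allFin)
  open import Data.List.Relation.Unary.Unique.Propositional using (Unique)
  import Data.List.Relation.Unary.Unique.Propositional.Properties as Unique
  open import Data.Product using (proj₁; proj₂)
  open import Data.Sum using (inj₁; inj₂)
  open import Data.Empty using (⊥)
  open import Function.Base using (_∘_; id)
  open import Function.Bundles using (_⇔_; mk⇔; Equivalence)

  δ : ∀ {r} → Fin (suc r) → ℕ
  δ Fin.zero    = 0
  δ (Fin.suc _) = 1

  codePoint : ∀ {r} → Fin (suc r) → Vec ℕ 3 → Vec ℤ 3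
  codePoint {r} σ (q ∷ a ∷ b ∷ []) = + (δ σ + (q + a)) ∷ + (δ σ + (q + b)) ∷ + (toℕ σ + q * suc r) ∷ []

  reevePoints : ℕ → ℕ → List (Vec ℤ 3)
  reevePoints r M =
    map (codePoint {r} Fin.zero) (simplexPoints 3 M) ++
    cartesianProductWith (codePoint ∘ Fin.suc) (allFin r) (innerSimplexPoints 3 M)

  remainder-quotient-injective : ∀ {r} (σ τ : Fin (suc r)) q p →
    toℕ σ + q * suc r ≡ toℕ τ + p * suc r → σ ≡ τ × q ≡ p
  remainder-quotient-injective {r} σ τ q p eq = σ≡τ , q≡p
    where
    remainder : ∀ (ρ : Fin (suc r)) k → (toℕ ρ + k * suc r) % suc r ≡ toℕ ρ
    remainder ρ k = trans ([m+kn]%n≡m%n (toℕ ρ) k (suc r)) (m<n⇒m%n≡m (Fin.toℕ<n ρ))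
    σ≡τ : σ ≡ τ
    σ≡τ = Fin.toℕ-injective (trans (sym (remainder σ q)) (trans (cong (_% suc r) eq) (remainder τ p)))
    q≡p : q ≡ p
    q≡p = ℕ.*-cancelʳ-≡ q p (suc r) (ℕ.+-cancelˡ-≡ (toℕ σ) _ _ (trans eq (cong (λ ρ → toℕ ρ + p * suc r) (sym σ≡τ))))

  codePoint-injective : ∀ {r} {σ τ : Fin (suc r)} {v w} → codePoint σ v ≡ codePoint τ w → σ ≡ τ × v ≡ w
  codePoint-injective {σ = σ} {τ} {q ∷ a ∷ b ∷ []} {p ∷ c ∷ d ∷ []} eq
    with x≡ , y≡z≡ ← Vec.∷-injective eq
    with y≡ , z≡ ← Vec.∷-injective y≡z≡
    with refl , refl ← remainder-quotient-injective σ τ q p (ℤ.+-injective (Vec.∷-injectiveˡ z≡))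
    = refl , cong₂ (λ a b → q ∷ a ∷ b ∷ []) (shift-injective x≡) (shift-injective y≡)
    where
    shift-injective : ∀ {a c} → + (δ σ + (q + a)) ≡ + (δ σ + (q + c)) → a ≡ c
    shift-injective e = ℕ.+-cancelˡ-≡ q _ _ (ℕ.+-cancelˡ-≡ (δ σ) _ _ (ℤ.+-injective e))

  reevePoints-unique : ∀ r M → Unique (reevePoints r M)
  reevePoints-unique r M =
    Unique.++⁺ (Unique.map⁺ (proj₂ ∘ codePoint-injective) (simplexPoints-unique 3 M))
               (Unique.cartesianProductWith⁺ (codePoint ∘ Fin.suc) upper-injective
                  (Unique.allFin⁺ r) (innerSimplexPoints-unique 3 M))
               disjoint
    where
    upper-injective : ∀ {i j : Fin r} {v w} → codePoint (Fin.suc i) v ≡ codePoint (Fin.suc j) w → i ≡ j × v ≡ w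
    upper-injective eq with refl , refl ← codePoint-injective eq = refl , refl
    disjoint : ∀ {p} → p ∈ map (codePoint Fin.zero) (simplexPoints 3 M) ×
                       p ∈ cartesianProductWith (codePoint ∘ Fin.suc) (allFin r) (innerSimplexPoints 3 M) → ⊥
    disjoint (p∈₁ , p∈₂)
      with _ , _ , p≡₁ ← ∈-map⁻ (codePoint Fin.zero) p∈₁
      with _ , _ , _ , _ , p≡₂ ← ∈-cartesianProductWith⁻ (codePoint ∘ Fin.suc) (allFin r) (innerSimplexPoints 3 M) p∈₂
      with () ← proj₁ (codePoint-injective (trans (sym p≡₁) p≡₂))

  toℕ≤h*δ : ∀ {r} (σ : Fin (suc r)) → toℕ σ ≤ suc r * δ σ
  toℕ≤h*δ Fin.zero    = z≤n
  toℕ≤h*δ {r} (Fin.suc i) = subst (toℕ (Fin.suc i) ≤_) (sym (ℕ.*-identityʳ (suc r))) (ℕ.<⇒≤ (Fin.toℕ<n (Fin.suc i)))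

  codePoint-facets : ∀ {r M} (σ : Fin (suc r)) v → 2 * δ σ + sum v ≤ M → ReeveFacets (suc r) M (codePoint σ v)
  codePoint-facets {r} {M} σ (q ∷ a ∷ b ∷ []) bound = reeveFacets (below a) (below b) (begin
    h * ((δ σ + (q + a)) + (δ σ + (q + b)))   ≡⟨ regroup h (δ σ) q a b ⟩
    h * (2 * δ σ + (q + (a + (b + 0)))) + q * h ≤⟨ ℕ.+-monoˡ-≤ (q * h) (ℕ.*-monoʳ-≤ h bound) ⟩
    h * M + q * h                             ≤⟨ ℕ.+-monoʳ-≤ (h * M) (ℕ.m≤n+m (q * h) (toℕ σ)) ⟩
    h * M + (toℕ σ + q * h)                   ∎)
    where
    open ℕ.≤-Reasoning
    h = suc r
    regroup : ∀ h d q a b → h * ((d + (q + a)) + (d + (q + b))) ≡ h * (2 * d + (q + (a + (b + 0)))) + q * h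
    regroup = solve-∀
    below : ∀ c → toℕ σ + q * h ≤ h * (δ σ + (q + c))
    below c = begin
      toℕ σ + q * h            ≤⟨ ℕ.+-mono-≤ (toℕ≤h*δ σ) (ℕ.≤-reflexive (ℕ.*-comm q h)) ⟩
      h * δ σ + h * q          ≤⟨ ℕ.+-monoʳ-≤ (h * δ σ) (ℕ.*-monoʳ-≤ h (ℕ.m≤m+n q c)) ⟩
      h * δ σ + h * (q + c)    ≡⟨ ℕ.*-distribˡ-+ h (δ σ) (q + c) ⟨
      h * (δ σ + (q + c))      ∎

  ceiling-≤ : ∀ {r} (σ : Fin (suc r)) q {x} → toℕ σ + q * suc r ≤ suc r * x → δ σ + q ≤ x
  ceiling-≤ {r} Fin.zero    q {x} le = ℕ.*-cancelʳ-≤ q x (suc r) (subst (q * suc r ≤_) (ℕ.*-comm (suc r) x) le)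
  ceiling-≤ {r} (Fin.suc i) q {x} le = ℕ.*-cancelʳ-< (suc r) q x (begin-strict
    q * suc r                   <⟨ s≤s (ℕ.m≤n+m (q * suc r) (toℕ i)) ⟩
    toℕ (Fin.suc i) + q * suc r ≤⟨ le ⟩
    suc r * x                   ≡⟨ ℕ.*-comm (suc r) x ⟩
    x * suc r                   ∎)
    where open ℕ.≤-Reasoning

  floor-≤ : ∀ {r M} (σ : Fin (suc r)) s → suc r * s ≤ suc r * M + toℕ σ → s ≤ M
  floor-≤ {r} {M} σ s le = ℕ.≤-pred (ℕ.*-cancelˡ-< (suc r) s (suc M) (begin-strict
    suc r * s         ≤⟨ le ⟩
    suc r * M + toℕ σ <⟨ ℕ.+-monoʳ-< (suc r * M) (Fin.toℕ<n σ) ⟩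
    suc r * M + suc r ≡⟨ ℕ.+-comm (suc r * M) (suc r) ⟩
    suc r + suc r * M ≡⟨ ℕ.*-suc (suc r) M ⟨
    suc r * suc M     ∎))
    where open ℕ.≤-Reasoning

  ReeveFacets⇒codePoint : ∀ {r M p} → ReeveFacets (suc r) M p →
    Σ (Fin (suc r)) λ σ → Σ (Vec ℕ 3) λ v → 2 * δ σ + sum v ≤ M × codePoint σ v ≡ p
  ReeveFacets⇒codePoint {r} {M} (reeveFacets {x} {y} {z} z≤hx z≤hy h[x+y]≤hM+z)
    with result q σ refl ← z divMod suc r
    with a , refl ← ℕ.m≤n⇒∃[o]m+o≡n (ceiling-≤ σ q z≤hx)
    with b , refl ← ℕ.m≤n⇒∃[o]m+o≡n (ceiling-≤ σ q z≤hy)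
    = σ , (q ∷ a ∷ b ∷ []) , floor-≤ σ _ (ℕ.+-cancelʳ-≤ (q * h) _ _ bound) , point≡
    where
    open ℕ.≤-Reasoning
    h = suc r
    regroup : ∀ h d q a b → h * (2 * d + (q + (a + (b + 0)))) + q * h ≡ h * ((d + q + a) + (d + q + b))
    regroup = solve-∀
    bound : h * (2 * δ σ + (q + (a + (b + 0)))) + q * h ≤ h * M + toℕ σ + q * h
    bound = begin
      h * (2 * δ σ + (q + (a + (b + 0)))) + q * h ≡⟨ regroup h (δ σ) q a b ⟩
      h * ((δ σ + q + a) + (δ σ + q + b))        ≤⟨ h[x+y]≤hM+z ⟩
      h * M + (toℕ σ + q * h)                    ≡⟨ ℕ.+-assoc (h * M) (toℕ σ) (q * h) ⟨
      h * M + toℕ σ + q * h                      ∎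
    point≡ : codePoint σ (q ∷ a ∷ b ∷ []) ≡ + (δ σ + q + a) ∷ + (δ σ + q + b) ∷ + (toℕ σ + q * h) ∷ []
    point≡ = sym (cong₂ (λ a b → + a ∷ + b ∷ + (toℕ σ + q * h) ∷ []) (ℕ.+-assoc (δ σ) q a) (ℕ.+-assoc (δ σ) q b))

  ∈-reevePoints⁻ : ∀ r M {p} → p ∈ reevePoints r M → ReeveFacets (suc r) M p
  ∈-reevePoints⁻ r M p∈ with ∈-++⁻ (map (codePoint Fin.zero) (simplexPoints 3 M)) p∈
  ... | inj₁ p∈₁ with v , v∈ , p≡ ← ∈-map⁻ (codePoint Fin.zero) p∈₁ =
    subst (ReeveFacets (suc r) M) (sym p≡) (codePoint-facets Fin.zero v (∈-simplexPoints⁻ 3 M v∈))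
  ... | inj₂ p∈₂ with i , v , _ , v∈ , p≡ ← ∈-cartesianProductWith⁻ (codePoint ∘ Fin.suc) (allFin r) (innerSimplexPoints 3 M) p∈₂ =
    subst (ReeveFacets (suc r) M) (sym p≡) (codePoint-facets (Fin.suc i) v (∈-innerSimplexPoints⁻ 3 M v∈))

  ∈-reevePoints⁺ : ∀ r M {p} → ReeveFacets (suc r) M p → p ∈ reevePoints r M
  ∈-reevePoints⁺ r M facets with ReeveFacets⇒codePoint facets
  ... | Fin.zero , v , bound , refl = ∈-++⁺ˡ (∈-map⁺ (codePoint Fin.zero) (∈-simplexPoints⁺ 3 M bound))
  ... | Fin.suc i , v , bound , refl =
    ∈-++⁺ʳ (map (codePoint Fin.zero) (simplexPoints 3 M))
      (∈-cartesianProductWith⁺ (codePoint ∘ Fin.suc) (∈-allFin i) (∈-innerSimplexPoints⁺ 3 M bound))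

  length-cartesianProductWith : ∀ {A B C : Set} (f : A → B → C) xs ys →
    length (cartesianProductWith f xs ys) ≡ length xs * length ys
  length-cartesianProductWith f []       ys = refl
  length-cartesianProductWith f (x ∷ xs) ys = trans (List.length-++ (map (f x) ys))
    (cong₂ _+_ (List.length-map (f x) ys) (length-cartesianProductWith f xs ys))

  length-reevePoints : ∀ r M →
    3 ! * length (reevePoints r M) ≡ risingFactorial (suc M) 3 + r * risingFactorial (M ∸ 1) 3
  length-reevePoints r M = begin
    3 ! * length (reevePoints r M)                 ≡⟨ cong (3 ! *_) layers ⟩
    3 ! * (length (simplexPoints 3 M) + r * length (innerSimplexPoints 3 M))
      ≡⟨ distribute (length (simplexPoints 3 M)) r (length (innerSimplexPoints 3 M)) ⟩
    3 ! * length (simplexPoints 3 M) + r * (3 ! * length (innerSimplexPoints 3 M))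
      ≡⟨ cong₂ (λ a b → a + r * b) (length-simplexPoints 3 M) (length-innerSimplexPoints 2 M) ⟩
    risingFactorial (suc M) 3 + r * risingFactorial (M ∸ 1) 3 ∎
    where
    open ≡-Reasoning
    distribute : ∀ a r b → 6 * (a + r * b) ≡ 6 * a + r * (6 * b)
    distribute = solve-∀
    layers : length (reevePoints r M) ≡ length (simplexPoints 3 M) + r * length (innerSimplexPoints 3 M)
    layers = begin
      length (reevePoints r M)
        ≡⟨ List.length-++ (map (codePoint Fin.zero) (simplexPoints 3 M)) ⟩
      length (map (codePoint Fin.zero) (simplexPoints 3 M)) +
        length (cartesianProductWith (codePoint ∘ Fin.suc) (allFin r) (innerSimplexPoints 3 M))
        ≡⟨ cong₂ _+_ (List.length-map (codePoint Fin.zero) (simplexPoints 3 M))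
                     (length-cartesianProductWith (codePoint ∘ Fin.suc) (allFin r) (innerSimplexPoints 3 M)) ⟩
      length (simplexPoints 3 M) + length (allFin r) * length (innerSimplexPoints 3 M)
        ≡⟨ cong (λ n → length (simplexPoints 3 M) + n * length (innerSimplexPoints 3 M)) (List.length-tabulate {n = r} id) ⟩
      length (simplexPoints 3 M) + r * length (innerSimplexPoints 3 M) ∎

  reevePoints⇔inDilate : ∀ r m p → p ∈ reevePoints r (suc m) ⇔ InDilate (reeve (suc r)) (suc m) p
  reevePoints⇔inDilate r m p = mk⇔
    (λ p∈ → Equivalence.from inDilate⇔ReeveFacets (∈-reevePoints⁻ r (suc m) p∈))
    (λ p∈ → ∈-reevePoints⁺ r (suc m) (Equivalence.to inDilate⇔ReeveFacets p∈))

module HeightTwelve where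

  open Embedding using (evalPolyℕ)
  open ReeveLatticePoints using (reevePoints; length-reevePoints)
  open import Data.Nat using (_+_)
  open import Data.Nat.Properties using (*-cancelˡ-≡)
  open import Data.Nat.Tactic.RingSolver using (solve-∀)
  open import Data.List using ([]; _∷_; length)

  ehrhartCoefficients : List ℕ
  ehrhartCoefficients = 1 ∷ 0 ∷ 1 ∷ 2 ∷ []

  reeveCount : ℕ → ℕ
  reeveCount M = length (reevePoints 11 M)

  reeveCount-polynomial : ∀ m → reeveCount (suc m) ≡ evalPolyℕ ehrhartCoefficients (suc m)
  reeveCount-polynomial m =
    *-cancelˡ-≡ (reeveCount (suc m)) _ 6 (trans (length-reevePoints 11 (suc m)) (expand m))
    where
    expand : ∀ m → suc (suc m) * (suc (suc (suc m)) * (suc (suc (suc (suc m))) * 1)) + 11 * (m * (suc m * (suc (suc m) * 1)))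
                 ≡ 6 * (1 + suc m * (0 + suc m * (1 + suc m * (2 + suc m * 0))))
    expand = solve-∀

open Embedding using (ℕtoℚ-evalPoly; allNonneg-ℕtoℚ)
open ReeveTetrahedron using (reeve)
open ReeveLatticePoints using (reevePoints; reevePoints-unique; reevePoints⇔inDilate)
open HeightTwelve using (ehrhartCoefficients; reeveCount; reeveCount-polynomial)

mainTheorem12 : Σ ℕ λ n → Σ ℕ λ k → Σ (Fin (suc k) → Vec ℤ n) λ vs →
    Σ (ℕ → ℕ) λ E →
      (E 0 ≡ 1) ×
      ((m : ℕ) → LatticeCount vs (suc m) (E (suc m))) ×
      (Σ (List ℚ) λ cs → AllNonneg cs × ((m : ℕ) → ℕtoℚ (E (suc m)) ≡ evalPoly cs (ℕtoℚ (suc m)))) ×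
      (Σ ℕ λ j → E (suc j) * E (suc j) < E j * E (suc (suc j)))
mainTheorem12 =
  3 , 3 , reeve 12 , reeveCount , refl ,
  (λ m → reevePoints 11 (suc m) , reevePoints-unique 11 (suc m) , refl , reevePoints⇔inDilate 11 m) ,
  (map ℕtoℚ ehrhartCoefficients , allNonneg-ℕtoℚ ehrhartCoefficients ,
   λ m → trans (cong ℕtoℚ (reeveCount-polynomial m)) (sym (ℕtoℚ-evalPoly ehrhartCoefficients (suc m)))) ,
  (0 , from-yes (reeveCount 1 * reeveCount 1 <? reeveCount 0 * reeveCount 2))
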